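{- Let $M=x^2+x+1\in\mathbb{F}_2[x]$, $r\ge 1$, and $A=M^{2^r}+M^{2^r-1}+\cdots+M+1$. With the Collatz transformations $(A_j)$ of $A$, for every $0\le k\le 2^r-2$ one has $A_{2k+1}=1+M^{k+1}(M+1)^{2^r-k-1}$ and $\deg(A_{2k+1})=\deg(A)$; moreover $A_{2(2^r-1)+1}=1$, and $\ell_A=2^r$.
   Context: For nonzero $A\in\mathbb{F}_2[x]$, the Collatz transformations are: $A_0=A$, and for $k\ge0$, $A_{2k+1}=A_{2k}/(x^{a_{2k}}(x+1)^{b_{2k}})$ where $a_{2k},b_{2k}$ are the multiplicities of $x$ and $x+1$ in $A_{2k}$, and $A_{2k+2}=1+MA_{2k+1}$. The length $\ell_A$ is $1+\min\{k\ge0: A_{2k+1}=1\}$, i.e. the number of terms of the sequence $A_1,A_3,A_5,\dots$ up to and including its first term equal to $1$. -}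

module Defs where

open import Data.Bool using (Bool; true; false; _xor_; if_then_else_; not)
open import Data.List using (List; []; _∷_; length)
open import Data.Nat using (ℕ; zero; suc; _+_; _∸_; _<_; _*_)
open import Data.Product using (Σ; _×_; _,_)
open import Relation.Binary.PropositionalEquality using (_≡_; _≢_)

-- Polynomials over F₂ as little-endian coefficient lists
-- (head = constant coefficient), kept in normal form (no trailing 'false').
Poly : Set
Poly = List Bool

norm : Poly → Poly
norm [] = []
norm (c ∷ cs) with norm cs
... | [] = if c then true ∷ [] else []
... | d ∷ ds = c ∷ d ∷ ds

zeroP oneP X X1 : Poly
zeroP = []
oneP = true ∷ []
X = false ∷ true ∷ []
X1 = true ∷ true ∷ []

addRaw : Poly → Poly → Poly
addRaw [] q = q
addRaw (p ∷ ps) [] = p ∷ ps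
addRaw (p ∷ ps) (q ∷ qs) = (p xor q) ∷ addRaw ps qs

_⊕_ : Poly → Poly → Poly
p ⊕ q = norm (addRaw p q)

mulRaw : Poly → Poly → Poly
mulRaw [] q = []
mulRaw (false ∷ ps) q = false ∷ mulRaw ps q
mulRaw (true ∷ ps) q = addRaw q (false ∷ mulRaw ps q)

_⊗_ : Poly → Poly → Poly
p ⊗ q = norm (mulRaw p q)

infixl 6 _⊕_
infixl 7 _⊗_

_^P_ : Poly → ℕ → Poly
p ^P zero = oneP
p ^P suc n = p ⊗ (p ^P n)

-- degree of a nonzero normalized polynomial
deg : Poly → ℕ
deg p = length p ∸ 1

M : Poly
M = true ∷ true ∷ true ∷ []

-- Division by x+1: p = (1+x) q  gives q_i = c_i + q_{i-1} (prefix xor);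
-- divisible iff the total xor of the coefficients is 0.
prefixXor : Bool → Poly → Poly
prefixXor acc [] = []
prefixXor acc (c ∷ cs) = (acc xor c) ∷ prefixXor (acc xor c) cs

-- returns (divisible?, quotient) for nonzero normalized input
divX1 : Poly → Bool × Poly
divX1 p = go (prefixXor false p)
  where
  go : Poly → Bool × Poly
  go [] = true , []
  go (q ∷ []) = not q , []
  go (q ∷ q' ∷ qs) with go (q' ∷ qs)
  ... | (b , r) = b , q ∷ r

removeX : Poly → Poly
removeX [] = []
removeX (false ∷ ps) = removeX ps
removeX (true ∷ ps) = true ∷ ps

-- remove all factors (x+1); fuel = length suffices (each division lowers degree)
removeX1fuel : ℕ → Poly → Poly
removeX1fuel zero p = p
removeX1fuel (suc n) [] = []
removeX1fuel (suc n) p with divX1 p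
... | (true , q) = removeX1fuel n (norm q)
... | (false , _) = p

-- odd part: A / (x^a (x+1)^b) with a, b the multiplicities of x and x+1 in A
oddPart : Poly → Poly
oddPart p = removeX1fuel (length p) (removeX (norm p))

isEven : ℕ → Bool
isEven zero = true
isEven (suc n) = not (isEven n)

-- Collatz transformations: A₀ = A,
-- A_{2k+1} = oddPart A_{2k},  A_{2k+2} = 1 + M A_{2k+1}
collatz : Poly → ℕ → Poly
collatz A zero = A
collatz A (suc n) =
  if isEven n then oddPart (collatz A n) else oneP ⊕ M ⊗ collatz A n

-- ℓ_A = ℓ  iff  ℓ = 1 + m where m is the least k with A_{2k+1} = 1
CollatzLength : Poly → ℕ → Set
CollatzLength A ℓ =
  Σ ℕ (λ m → (ℓ ≡ suc m) × (collatz A (2 * m + 1) ≡ oneP)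
               × ((k : ℕ) → k < m → collatz A (2 * k + 1) ≢ oneP))

geomSum : Poly → ℕ → Poly
geomSum P zero = oneP
geomSum P (suc n) = geomSum P n ⊕ (P ^P suc n)

-- Put S = M + 1 = x (x + 1).  Squaring is additive in characteristic 2, so
-- S ^ (2 ^ r) = M ^ (2 ^ r) + 1, and by doubling S ^ (2 ^ r - 1) = 1 + M + ⋯ + M ^ (2 ^ r - 1);
-- hence A = 1 + M S ^ (2 ^ r - 1).  If B = 1 + M ^ (k + 1) S ^ (d + 1), then
-- 1 + M B = S (1 + M ^ (k + 2) S ^ d) is x (x + 1) times a polynomial taking the value 1
-- at 0 and at 1, so the next odd iterate is 1 + M ^ (k + 2) S ^ d, again of degree
-- 2 (k + d + 2) = 2 ^ (r + 1).  Once d = 0, 1 + M B = S (1 + M ^ (2 ^ r)) = S ^ (2 ^ r + 1),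
-- whose odd part is 1.

module Submission where

open import Defs
open import Algebra using (CommutativeRing)
open import Algebra.Structures using (IsCommutativeRing)
open import Data.Bool using (Bool; true; false; _xor_; _∧_; not; if_then_else_)
open import Data.Bool.Properties
  using (xor-comm; xor-assoc; xor-identityʳ; xor-same; ∧-zeroʳ; ∧-assoc; not-involutive; xor-∧-commutativeRing)
open import Data.List using ([]; _∷_; length; map; replicate; _++_; drop)
open import Data.List.Properties using (map-id; length-replicate; length-++-≤ˡ)
open import Data.Maybe using (Maybe; just; nothing)
open import Data.Nat using (ℕ; zero; suc; _+_; _*_; _∸_; _^_; _≤_; _≥_; _<_; s≤s)
open import Data.Nat.Properties
  using (+-suc; +-comm; +-assoc; *-suc; *-identityˡ; *-distribʳ-+; m+[n∸m]≡n; m+n∸m≡n; m^n>0;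
         ≤-trans; ≤-reflexive; ≤-pred; m≤n+m; m≤m+n; m≤m*n; *-monoʳ-≤)
open import Data.Product using (_×_; _,_; proj₁; proj₂)
open import Function using (id)
open import Relation.Binary.PropositionalEquality
open import Tactic.RingSolver using (solve-∀)
open import Tactic.RingSolver.Core.AlmostCommutativeRing using (AlmostCommutativeRing; fromCommutativeRing)

coeff : Poly → ℕ → Bool
coeff []       _       = false
coeff (c ∷ _)  zero    = c
coeff (_ ∷ cs) (suc i) = coeff cs i

infix 4 _≈_
record _≈_ (p q : Poly) : Set where
  constructor coeffwise
  field coeff-≡ : ∀ i → coeff p i ≡ coeff q i
open _≈_

≈-refl : ∀ {p} → p ≈ p
≈-refl = coeffwise λ _ → refl

≈-sym : ∀ {p q} → p ≈ q → q ≈ p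
≈-sym e = coeffwise λ i → sym (coeff-≡ e i)

≈-trans : ∀ {p q r} → p ≈ q → q ≈ r → p ≈ r
≈-trans e f = coeffwise λ i → trans (coeff-≡ e i) (coeff-≡ f i)

≡⇒≈ : ∀ {p q} → p ≡ q → p ≈ q
≡⇒≈ refl = ≈-refl

∷-congʳ : ∀ {c p q} → p ≈ q → c ∷ p ≈ c ∷ q
∷-congʳ e = coeffwise λ { zero → refl ; (suc i) → coeff-≡ e i }

false∷-≈[] : ∀ {p} → p ≈ [] → false ∷ p ≈ []
false∷-≈[] e = coeffwise λ { zero → refl ; (suc i) → coeff-≡ e i }

drop₁-≈ : ∀ {p q} → p ≈ q → drop 1 p ≈ drop 1 q
drop₁-≈ {p} {q} e = coeffwise λ i → trans (coeff-drop₁ p i) (trans (coeff-≡ e (suc i)) (sym (coeff-drop₁ q i)))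
  where
  coeff-drop₁ : ∀ p i → coeff (drop 1 p) i ≡ coeff p (suc i)
  coeff-drop₁ []      _ = refl
  coeff-drop₁ (_ ∷ _) _ = refl

coeff-addRaw : ∀ p q i → coeff (addRaw p q) i ≡ coeff p i xor coeff q i
coeff-addRaw []       q        i       = refl
coeff-addRaw (c ∷ cs) []       i       = sym (xor-identityʳ _)
coeff-addRaw (c ∷ cs) (d ∷ ds) zero    = refl
coeff-addRaw (c ∷ cs) (d ∷ ds) (suc i) = coeff-addRaw cs ds i

addRaw-cong : ∀ {p p' q q'} → p ≈ p' → q ≈ q' → addRaw p q ≈ addRaw p' q'
addRaw-cong {p} {p'} {q} {q'} e f = coeffwise λ i →
  trans (coeff-addRaw p q i) (trans (cong₂ _xor_ (coeff-≡ e i) (coeff-≡ f i)) (sym (coeff-addRaw p' q' i)))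

addRaw-comm : ∀ p q → addRaw p q ≡ addRaw q p
addRaw-comm []       []       = refl
addRaw-comm []       (_ ∷ _)  = refl
addRaw-comm (_ ∷ _)  []       = refl
addRaw-comm (c ∷ cs) (d ∷ ds) = cong₂ _∷_ (xor-comm c d) (addRaw-comm cs ds)

addRaw-assoc : ∀ p q r → addRaw (addRaw p q) r ≡ addRaw p (addRaw q r)
addRaw-assoc []       _        _        = refl
addRaw-assoc (_ ∷ _)  []       _        = refl
addRaw-assoc (_ ∷ _)  (_ ∷ _)  []       = refl
addRaw-assoc (c ∷ cs) (d ∷ ds) (e ∷ es) = cong₂ _∷_ (xor-assoc c d e) (addRaw-assoc cs ds es)

addRaw-identityʳ : ∀ p → addRaw p [] ≡ p
addRaw-identityʳ []      = refl
addRaw-identityʳ (_ ∷ _) = refl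

addRaw-self : ∀ p → addRaw p p ≈ []
addRaw-self p = coeffwise λ i → trans (coeff-addRaw p p i) (xor-same (coeff p i))

addRaw-false : ∀ p → addRaw p (false ∷ []) ≈ p
addRaw-false p = ≈-trans (addRaw-cong (≈-refl {p}) (false∷-≈[] ≈-refl)) (≡⇒≈ (addRaw-identityʳ p))

addRaw-leftComm : ∀ b c d → addRaw b (addRaw c d) ≡ addRaw c (addRaw b d)
addRaw-leftComm b c d =
  trans (sym (addRaw-assoc b c d)) (trans (cong (λ x → addRaw x d) (addRaw-comm b c)) (addRaw-assoc c b d))

addRaw-interchange : ∀ a b c d → addRaw (addRaw a b) (addRaw c d) ≡ addRaw (addRaw a c) (addRaw b d)
addRaw-interchange a b c d = begin
  addRaw (addRaw a b) (addRaw c d)  ≡⟨ addRaw-assoc a b _ ⟩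
  addRaw a (addRaw b (addRaw c d))  ≡⟨ cong (addRaw a) (addRaw-leftComm b c d) ⟩
  addRaw a (addRaw c (addRaw b d))  ≡⟨ addRaw-assoc a c _ ⟨
  addRaw (addRaw a c) (addRaw b d)  ∎
  where open ≡-Reasoning

mulRaw-congʳ : ∀ p {q q'} → q ≈ q' → mulRaw p q ≈ mulRaw p q'
mulRaw-congʳ []           e = ≈-refl
mulRaw-congʳ (false ∷ p)  e = ∷-congʳ (mulRaw-congʳ p e)
mulRaw-congʳ (true ∷ p)   e = addRaw-cong e (∷-congʳ (mulRaw-congʳ p e))

mulRaw-distribˡ : ∀ p q r → mulRaw p (addRaw q r) ≈ addRaw (mulRaw p q) (mulRaw p r)
mulRaw-distribˡ []          q r = ≈-refl
mulRaw-distribˡ (false ∷ p) q r = ∷-congʳ (mulRaw-distribˡ p q r)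
mulRaw-distribˡ (true ∷ p)  q r =
  ≈-trans (addRaw-cong ≈-refl (∷-congʳ (mulRaw-distribˡ p q r)))
          (≡⇒≈ (addRaw-interchange q r (false ∷ mulRaw p q) (false ∷ mulRaw p r)))

mulRaw-zeroʳ : ∀ p → mulRaw p [] ≈ []
mulRaw-zeroʳ []          = ≈-refl
mulRaw-zeroʳ (false ∷ p) = false∷-≈[] (mulRaw-zeroʳ p)
mulRaw-zeroʳ (true ∷ p)  = false∷-≈[] (mulRaw-zeroʳ p)

mulRaw-falseʳ : ∀ q p → mulRaw q (false ∷ p) ≈ false ∷ mulRaw q p
mulRaw-falseʳ []          p = ≈-sym (false∷-≈[] ≈-refl)
mulRaw-falseʳ (false ∷ q) p = ∷-congʳ (mulRaw-falseʳ q p)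
mulRaw-falseʳ (true ∷ q)  p = ∷-congʳ (addRaw-cong ≈-refl (mulRaw-falseʳ q p))

mulRaw-trueʳ : ∀ q p → mulRaw q (true ∷ p) ≈ addRaw q (false ∷ mulRaw q p)
mulRaw-trueʳ []          p = ≈-sym (false∷-≈[] ≈-refl)
mulRaw-trueʳ (false ∷ q) p = ∷-congʳ (mulRaw-trueʳ q p)
mulRaw-trueʳ (true ∷ q)  p =
  ∷-congʳ (≈-trans (addRaw-cong ≈-refl (mulRaw-trueʳ q p)) (≡⇒≈ (addRaw-leftComm p q _)))

mulRaw-comm : ∀ p q → mulRaw p q ≈ mulRaw q p
mulRaw-comm []          q = ≈-sym (mulRaw-zeroʳ q)
mulRaw-comm (false ∷ p) q = ≈-trans (∷-congʳ (mulRaw-comm p q)) (≈-sym (mulRaw-falseʳ q p))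
mulRaw-comm (true ∷ p)  q =
  ≈-trans (addRaw-cong ≈-refl (∷-congʳ (mulRaw-comm p q))) (≈-sym (mulRaw-trueʳ q p))

mulRaw-congˡ : ∀ {p p'} q → p ≈ p' → mulRaw p q ≈ mulRaw p' q
mulRaw-congˡ {p} {p'} q e = ≈-trans (mulRaw-comm p q) (≈-trans (mulRaw-congʳ q e) (mulRaw-comm q p'))

mulRaw-distribʳ : ∀ p q r → mulRaw (addRaw q r) p ≈ addRaw (mulRaw q p) (mulRaw r p)
mulRaw-distribʳ p q r =
  ≈-trans (mulRaw-comm (addRaw q r) p)
    (≈-trans (mulRaw-distribˡ p q r) (addRaw-cong (mulRaw-comm p q) (mulRaw-comm p r)))

mulRaw-assoc : ∀ p q r → mulRaw (mulRaw p q) r ≈ mulRaw p (mulRaw q r)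
mulRaw-assoc []          q r = ≈-refl
mulRaw-assoc (false ∷ p) q r = ∷-congʳ (mulRaw-assoc p q r)
mulRaw-assoc (true ∷ p)  q r =
  ≈-trans (mulRaw-distribʳ r q (false ∷ mulRaw p q)) (addRaw-cong ≈-refl (∷-congʳ (mulRaw-assoc p q r)))

mulRaw-identityˡ : ∀ q → mulRaw oneP q ≈ q
mulRaw-identityˡ = addRaw-false

consNorm : Bool → Poly → Poly
consNorm c []       = if c then true ∷ [] else []
consNorm c (d ∷ ds) = c ∷ d ∷ ds

norm-∷ : ∀ c cs → norm (c ∷ cs) ≡ consNorm c (norm cs)
norm-∷ c cs with norm cs
... | []     = refl
... | _ ∷ _  = refl

consNorm-≈ : ∀ c p → consNorm c p ≈ c ∷ p
consNorm-≈ true  []      = ≈-refl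
consNorm-≈ false []      = ≈-sym (false∷-≈[] ≈-refl)
consNorm-≈ c     (_ ∷ _) = ≈-refl

norm-≈ : ∀ p → norm p ≈ p
norm-≈ []       = ≈-refl
norm-≈ (c ∷ cs) = ≈-trans (≡⇒≈ (norm-∷ c cs)) (≈-trans (consNorm-≈ c (norm cs)) (∷-congʳ (norm-≈ cs)))

norm-by-head : ∀ p → norm p ≡ consNorm (coeff p 0) (norm (drop 1 p))
norm-by-head []       = refl
norm-by-head (c ∷ cs) = norm-∷ c cs

norm-≡-by-tails : ∀ {p q} → p ≈ q → norm (drop 1 p) ≡ norm (drop 1 q) → norm p ≡ norm q
norm-≡-by-tails {p} {q} e tails =
  trans (norm-by-head p) (trans (cong₂ consNorm (coeff-≡ e 0) tails) (sym (norm-by-head q)))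

norm-cong : ∀ {p q} → p ≈ q → norm p ≡ norm q
norm-cong {[]}     {[]}     _ = refl
norm-cong {[]}     {_ ∷ ds} e = norm-≡-by-tails e (norm-cong {[]} {ds} (drop₁-≈ e))
norm-cong {_ ∷ cs} {[]}     e = norm-≡-by-tails e (norm-cong {cs} {[]} (drop₁-≈ e))
norm-cong {_ ∷ cs} {_ ∷ ds} e = norm-≡-by-tails e (norm-cong {cs} {ds} (drop₁-≈ e))

Normal : Poly → Set
Normal p = norm p ≡ p

norm-Normal : ∀ p → Normal (norm p)
norm-Normal p = norm-cong (norm-≈ p)

Normal-≈⇒≡ : ∀ {p q} → Normal p → Normal q → p ≈ q → p ≡ q
Normal-≈⇒≡ np nq e = trans (sym np) (trans (norm-cong e) nq)

-- The commutative ring F₂[x]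

⊕≈addRaw : ∀ p q → p ⊕ q ≈ addRaw p q
⊕≈addRaw p q = norm-≈ (addRaw p q)

⊗≈mulRaw : ∀ p q → p ⊗ q ≈ mulRaw p q
⊗≈mulRaw p q = norm-≈ (mulRaw p q)

⊕-cong : ∀ {p p' q q'} → p ≈ p' → q ≈ q' → p ⊕ q ≈ p' ⊕ q'
⊕-cong e f = ≡⇒≈ (norm-cong (addRaw-cong e f))

⊗-cong : ∀ {p p' q q'} → p ≈ p' → q ≈ q' → p ⊗ q ≈ p' ⊗ q'
⊗-cong {p' = p'} {q = q} e f = ≡⇒≈ (norm-cong (≈-trans (mulRaw-congˡ q e) (mulRaw-congʳ p' f)))

⊕-assoc : ∀ p q r → (p ⊕ q) ⊕ r ≈ p ⊕ (q ⊕ r)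
⊕-assoc p q r = ≡⇒≈ (norm-cong (
  ≈-trans (addRaw-cong (⊕≈addRaw p q) ≈-refl)
    (≈-trans (≡⇒≈ (addRaw-assoc p q r)) (addRaw-cong (≈-refl {p}) (≈-sym (⊕≈addRaw q r))))))

⊕-comm : ∀ p q → p ⊕ q ≈ q ⊕ p
⊕-comm p q = ≡⇒≈ (cong norm (addRaw-comm p q))

⊕-identityˡ : ∀ p → [] ⊕ p ≈ p
⊕-identityˡ p = ⊕≈addRaw [] p

⊕-identityʳ : ∀ p → p ⊕ [] ≈ p
⊕-identityʳ p = ≈-trans (⊕-comm p []) (⊕-identityˡ p)

⊕-self : ∀ p → p ⊕ p ≈ []
⊕-self p = ≡⇒≈ (norm-cong (addRaw-self p))

⊗-assoc : ∀ p q r → (p ⊗ q) ⊗ r ≈ p ⊗ (q ⊗ r)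
⊗-assoc p q r = ≡⇒≈ (norm-cong (
  ≈-trans (mulRaw-congˡ r (⊗≈mulRaw p q))
    (≈-trans (mulRaw-assoc p q r) (mulRaw-congʳ p (≈-sym (⊗≈mulRaw q r))))))

⊗-comm : ∀ p q → p ⊗ q ≈ q ⊗ p
⊗-comm p q = ≡⇒≈ (norm-cong (mulRaw-comm p q))

⊗-identityˡ : ∀ p → oneP ⊗ p ≈ p
⊗-identityˡ p = ≈-trans (⊗≈mulRaw oneP p) (mulRaw-identityˡ p)

⊗-identityʳ : ∀ p → p ⊗ oneP ≈ p
⊗-identityʳ p = ≈-trans (⊗-comm p oneP) (⊗-identityˡ p)

⊗-distribˡ : ∀ p q r → p ⊗ (q ⊕ r) ≈ p ⊗ q ⊕ p ⊗ r
⊗-distribˡ p q r = ≡⇒≈ (norm-cong (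
  ≈-trans (mulRaw-congʳ p (⊕≈addRaw q r))
    (≈-trans (mulRaw-distribˡ p q r) (addRaw-cong (≈-sym (⊗≈mulRaw p q)) (≈-sym (⊗≈mulRaw p r))))))

⊗-distribʳ : ∀ p q r → (q ⊕ r) ⊗ p ≈ q ⊗ p ⊕ r ⊗ p
⊗-distribʳ p q r =
  ≈-trans (⊗-comm (q ⊕ r) p) (≈-trans (⊗-distribˡ p q r) (⊕-cong (⊗-comm p q) (⊗-comm p r)))

F₂[x]-isCommutativeRing : IsCommutativeRing _≈_ _⊕_ _⊗_ id [] oneP
F₂[x]-isCommutativeRing = record
  { isRing = record
    { +-isAbelianGroup = record
      { isGroup = record
        { isMonoid = record
          { isSemigroup = record
            { isMagma = record
              { isEquivalence = record { refl = ≈-refl ; sym = ≈-sym ; trans = ≈-trans }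
              ; ∙-cong = ⊕-cong
              }
            ; assoc = ⊕-assoc
            }
          ; identity = ⊕-identityˡ , ⊕-identityʳ
          }
        ; inverse = ⊕-self , ⊕-self
        ; ⁻¹-cong = id
        }
      ; comm = ⊕-comm
      }
    ; *-cong = ⊗-cong
    ; *-assoc = ⊗-assoc
    ; *-identity = ⊗-identityˡ , ⊗-identityʳ
    ; distrib = ⊗-distribˡ , ⊗-distribʳ
    }
  ; *-comm = ⊗-comm
  }

F₂[x] : CommutativeRing _ _
F₂[x] = record { isCommutativeRing = F₂[x]-isCommutativeRing }

F₂[x]-solver : AlmostCommutativeRing _ _
F₂[x]-solver = fromCommutativeRing F₂[x] isZero?
  where
  -- Closed coefficients compute, so oneP ⊕ oneP is seen to be zero: the solver knows 2 = 0.
  isZero? : ∀ p → Maybe ([] ≈ p)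
  isZero? [] = just ≈-refl
  isZero? _  = nothing

open import Algebra.Properties.Semiring.Exp (CommutativeRing.semiring F₂[x])
  using (^-homo-*; ^-congˡ; ^-assocʳ) renaming (_^_ to _^ᴿ_)
import Relation.Binary.Reasoning.Setoid as SetoidReasoning
module ≈-Reasoning = SetoidReasoning (CommutativeRing.setoid F₂[x])

^P≡^ᴿ : ∀ p n → p ^P n ≡ p ^ᴿ n
^P≡^ᴿ p zero    = refl
^P≡^ᴿ p (suc n) = cong (p ⊗_) (^P≡^ᴿ p n)

^P-homo : ∀ p m n → p ^P (m + n) ≈ p ^P m ⊗ p ^P n
^P-homo p m n rewrite ^P≡^ᴿ p (m + n) | ^P≡^ᴿ p m | ^P≡^ᴿ p n = ^-homo-* p m n

^P-cong : ∀ n {p q} → p ≈ q → p ^P n ≈ q ^P n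
^P-cong n {p} {q} e rewrite ^P≡^ᴿ p n | ^P≡^ᴿ q n = ^-congˡ n e

^P-double : ∀ p n → p ^P (2 * n) ≈ (p ⊗ p) ^P n
^P-double p n rewrite ^P≡^ᴿ p (2 * n) | ^P≡^ᴿ (p ⊗ p) n =
  ≈-trans (≈-sym (^-assocʳ p 2 n)) (^-congˡ n (⊗-cong (≈-refl {p}) (⊗-identityʳ p)))

frobenius : ∀ r a → (a ⊕ oneP) ^P (2 ^ r) ≈ a ^P (2 ^ r) ⊕ oneP
frobenius zero    a = ⊗-distribʳ oneP a oneP
frobenius (suc r) a = begin
  (a ⊕ oneP) ^P (2 * 2 ^ r)                ≈⟨ ^P-double (a ⊕ oneP) (2 ^ r) ⟩
  ((a ⊕ oneP) ⊗ (a ⊕ oneP)) ^P (2 ^ r)     ≈⟨ ^P-cong (2 ^ r) (square-⊕-one a) ⟩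
  (a ⊗ a ⊕ oneP) ^P (2 ^ r)                ≈⟨ frobenius r (a ⊗ a) ⟩
  (a ⊗ a) ^P (2 ^ r) ⊕ oneP                ≈⟨ ⊕-cong (^P-double a (2 ^ r)) ≈-refl ⟨
  a ^P (2 * 2 ^ r) ⊕ oneP                  ∎
  where
  open ≈-Reasoning
  square-⊕-one : ∀ a → (a ⊕ oneP) ⊗ (a ⊕ oneP) ≈ a ⊗ a ⊕ oneP
  square-⊕-one = solve-∀ F₂[x]-solver

geomSum-suc : ∀ p n → geomSum p (suc n) ≈ oneP ⊕ p ⊗ geomSum p n
geomSum-suc p zero    = ≈-refl
geomSum-suc p (suc n) = begin
  geomSum p (suc n) ⊕ p ⊗ p ^P suc n                ≈⟨ ⊕-cong (geomSum-suc p n) ≈-refl ⟩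
  (oneP ⊕ p ⊗ geomSum p n) ⊕ p ⊗ p ^P suc n         ≈⟨ factor p (geomSum p n) (p ^P suc n) ⟩
  oneP ⊕ p ⊗ (geomSum p n ⊕ p ^P suc n)             ∎
  where
  open ≈-Reasoning
  factor : ∀ p g h → (oneP ⊕ p ⊗ g) ⊕ p ⊗ h ≈ oneP ⊕ p ⊗ (g ⊕ h)
  factor = solve-∀ F₂[x]-solver

geomSum-split : ∀ p a b → geomSum p (a + suc b) ≈ geomSum p b ⊕ p ^P suc b ⊗ geomSum p a
geomSum-split p zero    b = ⊕-cong (≈-refl {geomSum p b}) (≈-sym (⊗-identityʳ (p ^P suc b)))
geomSum-split p (suc a) b = begin
  geomSum p (a + suc b) ⊕ p ^P (suc a + suc b)
    ≈⟨ ⊕-cong (geomSum-split p a b) (^P-homo p (suc a) (suc b)) ⟩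
  (geomSum p b ⊕ p ^P suc b ⊗ geomSum p a) ⊕ p ^P suc a ⊗ p ^P suc b
    ≈⟨ factor (geomSum p b) (p ^P suc b) (geomSum p a) (p ^P suc a) ⟩
  geomSum p b ⊕ p ^P suc b ⊗ (geomSum p a ⊕ p ^P suc a)
    ∎
  where
  open ≈-Reasoning
  factor : ∀ g y x q → (g ⊕ y ⊗ x) ⊕ q ⊗ y ≈ g ⊕ y ⊗ (x ⊕ q)
  factor = solve-∀ F₂[x]-solver

S : Poly
S = M ⊕ oneP

2^r≡suc : ∀ r → 2 ^ r ≡ suc (2 ^ r ∸ 1)
2^r≡suc r = sym (m+[n∸m]≡n (m^n>0 2 r))

S^≈geomSum : ∀ r → S ^P (2 ^ r ∸ 1) ≈ geomSum M (2 ^ r ∸ 1)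
S^≈geomSum zero    = ≈-refl
S^≈geomSum (suc r) = begin
  S ^P (2 ^ suc r ∸ 1)                    ≡⟨ cong (S ^P_) index ⟩
  S ^P (h + suc h)                        ≈⟨ ^P-homo S h (suc h) ⟩
  S ^P h ⊗ S ^P suc h                     ≈⟨ ⊗-cong (S^≈geomSum r) S^2^r ⟩
  geomSum M h ⊗ (M ^P suc h ⊕ oneP)       ≈⟨ expand (geomSum M h) (M ^P suc h) ⟩
  geomSum M h ⊕ M ^P suc h ⊗ geomSum M h  ≈⟨ geomSum-split M h h ⟨
  geomSum M (h + suc h)                   ≡⟨ cong (geomSum M) index ⟨
  geomSum M (2 ^ suc r ∸ 1)               ∎
  where
  open ≈-Reasoning
  h : ℕ
  h = 2 ^ r ∸ 1
  index : 2 ^ suc r ∸ 1 ≡ h + suc h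
  index = trans (cong (λ n → 2 ^ r + n ∸ 1) (*-identityˡ (2 ^ r))) (cong (λ n → n + n ∸ 1) (2^r≡suc r))
  S^2^r : S ^P suc h ≈ M ^P suc h ⊕ oneP
  S^2^r = subst (λ n → S ^P n ≈ M ^P n ⊕ oneP) (2^r≡suc r) (frobenius r M)
  expand : ∀ g m → g ⊗ (m ⊕ oneP) ≈ g ⊕ m ⊗ g
  expand = solve-∀ F₂[x]-solver

collatzForm : ℕ → ℕ → Poly
collatzForm k d = oneP ⊕ M ^P (k + 1) ⊗ S ^P d

geomSum≈collatzForm : ∀ r → geomSum M (2 ^ r) ≈ collatzForm 0 (2 ^ r ∸ 1)
geomSum≈collatzForm r = begin
  geomSum M (2 ^ r)             ≡⟨ cong (geomSum M) (2^r≡suc r) ⟩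
  geomSum M (suc h)             ≈⟨ geomSum-suc M h ⟩
  oneP ⊕ M ⊗ geomSum M h        ≈⟨ ⊕-cong (≈-refl {oneP}) (⊗-cong (⊗-identityʳ M) (S^≈geomSum r)) ⟨
  oneP ⊕ M ^P 1 ⊗ S ^P h        ∎
  where
  open ≈-Reasoning
  h : ℕ
  h = 2 ^ r ∸ 1

collatzForm-step : ∀ k d → oneP ⊕ M ⊗ collatzForm k (suc d) ≈ S ⊗ collatzForm (suc k) d
collatzForm-step k d = identity M (M ^P (k + 1)) (S ^P d)
  where
  identity : ∀ m a b → oneP ⊕ m ⊗ (oneP ⊕ a ⊗ ((m ⊕ oneP) ⊗ b)) ≈ (m ⊕ oneP) ⊗ (oneP ⊕ (m ⊗ a) ⊗ b)
  identity = solve-∀ F₂[x]-solver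

collatzForm-last : ∀ r k → k + 1 ≡ 2 ^ r → collatzForm k 0 ≈ S ^P (2 ^ r)
collatzForm-last r k k+1≡2^r = begin
  oneP ⊕ M ^P (k + 1) ⊗ oneP    ≈⟨ ⊕-cong (≈-refl {oneP}) (⊗-identityʳ (M ^P (k + 1))) ⟩
  oneP ⊕ M ^P (k + 1)           ≡⟨ cong (λ n → oneP ⊕ M ^P n) k+1≡2^r ⟩
  oneP ⊕ M ^P (2 ^ r)           ≈⟨ ⊕-comm oneP (M ^P (2 ^ r)) ⟩
  M ^P (2 ^ r) ⊕ oneP           ≈⟨ frobenius r M ⟨
  S ^P (2 ^ r)                  ∎
  where open ≈-Reasoning

-- Evaluation at 0 and 1

F₂ : AlmostCommutativeRing _ _
F₂ = fromCommutativeRing xor-∧-commutativeRing isFalse?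
  where
  isFalse? : ∀ b → Maybe (false ≡ b)
  isFalse? false = just refl
  isFalse? true  = nothing

eval : Bool → Poly → Bool
eval b []       = false
eval b (c ∷ cs) = c xor (b ∧ eval b cs)

eval-addRaw : ∀ b p q → eval b (addRaw p q) ≡ eval b p xor eval b q
eval-addRaw b []       q        = refl
eval-addRaw b (c ∷ cs) []       = sym (xor-identityʳ _)
eval-addRaw b (c ∷ cs) (d ∷ ds) =
  trans (cong (λ e → (c xor d) xor (b ∧ e)) (eval-addRaw b cs ds)) (interchange c d b (eval b cs) (eval b ds))
  where
  interchange : ∀ c d b e f → (c xor d) xor (b ∧ (e xor f)) ≡ (c xor (b ∧ e)) xor (d xor (b ∧ f))
  interchange = solve-∀ F₂

eval-mulRaw : ∀ b p q → eval b (mulRaw p q) ≡ eval b p ∧ eval b q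
eval-mulRaw b []          q = refl
eval-mulRaw b (false ∷ p) q = trans (cong (b ∧_) (eval-mulRaw b p q)) (sym (∧-assoc b (eval b p) (eval b q)))
eval-mulRaw b (true ∷ p)  q =
  trans (eval-addRaw b q (false ∷ mulRaw p q))
    (trans (cong (λ e → eval b q xor (b ∧ e)) (eval-mulRaw b p q)) (expand (eval b q) b (eval b p)))
  where
  expand : ∀ y b x → y xor (b ∧ (x ∧ y)) ≡ (true xor (b ∧ x)) ∧ y
  expand = solve-∀ F₂

eval-consNorm : ∀ b c p → eval b (consNorm c p) ≡ eval b (c ∷ p)
eval-consNorm b true  []      = refl
eval-consNorm b false []      = sym (∧-zeroʳ b)
eval-consNorm b c     (_ ∷ _) = refl

eval-norm : ∀ b p → eval b (norm p) ≡ eval b p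
eval-norm b []       = refl
eval-norm b (c ∷ cs) =
  trans (cong (eval b) (norm-∷ c cs))
    (trans (eval-consNorm b c (norm cs)) (cong (λ e → c xor (b ∧ e)) (eval-norm b cs)))

eval-⊕ : ∀ b p q → eval b (p ⊕ q) ≡ eval b p xor eval b q
eval-⊕ b p q = trans (eval-norm b (addRaw p q)) (eval-addRaw b p q)

eval-⊗ : ∀ b p q → eval b (p ⊗ q) ≡ eval b p ∧ eval b q
eval-⊗ b p q = trans (eval-norm b (mulRaw p q)) (eval-mulRaw b p q)

eval-oneP : ∀ b → eval b oneP ≡ true
eval-oneP false = refl
eval-oneP true  = refl

eval-S : ∀ b → eval b S ≡ false
eval-S false = refl
eval-S true  = refl

eval-collatzForm : ∀ b k d → eval b (collatzForm k (suc d)) ≡ true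
eval-collatzForm b k d = begin
  eval b (oneP ⊕ Mᵏ⁺¹ ⊗ (S ⊗ Sᵈ))             ≡⟨ eval-⊕ b oneP (Mᵏ⁺¹ ⊗ (S ⊗ Sᵈ)) ⟩
  eval b oneP xor eval b (Mᵏ⁺¹ ⊗ (S ⊗ Sᵈ))    ≡⟨ cong₂ _xor_ (eval-oneP b) (eval-⊗ b Mᵏ⁺¹ (S ⊗ Sᵈ)) ⟩
  true xor (eval b Mᵏ⁺¹ ∧ eval b (S ⊗ Sᵈ))    ≡⟨ cong (λ e → true xor (eval b Mᵏ⁺¹ ∧ e)) S⊗Sᵈ-root ⟩
  true xor (eval b Mᵏ⁺¹ ∧ false)              ≡⟨ cong (true xor_) (∧-zeroʳ (eval b Mᵏ⁺¹)) ⟩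
  true                                        ∎
  where
  open ≡-Reasoning
  Mᵏ⁺¹ Sᵈ : Poly
  Mᵏ⁺¹ = M ^P (k + 1)
  Sᵈ = S ^P d
  S⊗Sᵈ-root : eval b (S ⊗ Sᵈ) ≡ false
  S⊗Sᵈ-root = trans (eval-⊗ b S Sᵈ) (cong (_∧ eval b Sᵈ) (eval-S b))

data Monic : ℕ → Poly → Set where
  monic-one : Monic 0 (true ∷ [])
  monic-∷   : ∀ c {n p} → Monic n p → Monic (suc n) (c ∷ p)

Monic-length : ∀ {n p} → Monic n p → length p ≡ suc n
Monic-length monic-one     = refl
Monic-length (monic-∷ _ m) = cong suc (Monic-length m)

deg-Monic : ∀ {n p} → Monic n p → deg p ≡ n
deg-Monic m = cong (_∸ 1) (Monic-length m)

Monic⇒Normal : ∀ {n p} → Monic n p → Normal p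
Monic⇒Normal monic-one               = refl
Monic⇒Normal (monic-∷ c {p = p} m) =
  trans (norm-∷ c p) (trans (cong (consNorm c) (Monic⇒Normal m)) (consNorm-Monic m))
  where
  consNorm-Monic : ∀ {n p} → Monic n p → consNorm c p ≡ c ∷ p
  consNorm-Monic monic-one     = refl
  consNorm-Monic (monic-∷ _ _) = refl

Monic-addRaw : ∀ {n p q} → Monic n q → length p ≤ n → Monic n (addRaw p q)
Monic-addRaw {p = []}    mq             _         = mq
Monic-addRaw {p = c ∷ _} (monic-∷ d mq) (s≤s len) = monic-∷ (c xor d) (Monic-addRaw mq len)

Monic-mulRaw : ∀ {m n p q} → Monic m p → Monic n q → Monic (m + n) (mulRaw p q)
Monic-mulRaw monic-one mq = subst (Monic _) (sym (addRaw-false-Monic mq)) mq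
  where
  addRaw-false-Monic : ∀ {n q} → Monic n q → addRaw q (false ∷ []) ≡ q
  addRaw-false-Monic monic-one             = refl
  addRaw-false-Monic (monic-∷ c {p = p} _) = cong₂ _∷_ (xor-identityʳ c) (addRaw-identityʳ p)
Monic-mulRaw (monic-∷ false mp) mq = monic-∷ false (Monic-mulRaw mp mq)
Monic-mulRaw {n = n} (monic-∷ true {m} mp) mq =
  Monic-addRaw (monic-∷ false (Monic-mulRaw mp mq)) (≤-trans (≤-reflexive (Monic-length mq)) (s≤s (m≤n+m n m)))

Monic-⊗ : ∀ {m n p q} → Monic m p → Monic n q → Monic (m + n) (p ⊗ q)
Monic-⊗ {m} {n} {p} {q} mp mq = subst (Monic (m + n)) (sym (Monic⇒Normal mpq)) mpq
  where
  mpq : Monic (m + n) (mulRaw p q)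
  mpq = Monic-mulRaw mp mq

Monic-⊕ : ∀ {n p q} → Monic n q → length p ≤ n → Monic n (p ⊕ q)
Monic-⊕ {n} {p} {q} mq len = subst (Monic n) (sym (Monic⇒Normal mpq)) mpq
  where
  mpq : Monic n (addRaw p q)
  mpq = Monic-addRaw {p = p} mq len

Monic-^P : ∀ {m p} → Monic m p → ∀ n → Monic (n * m) (p ^P n)
Monic-^P mp zero    = monic-one
Monic-^P mp (suc n) = Monic-⊗ mp (Monic-^P mp n)

Monic-collatzForm : ∀ k d → Monic ((k + 1) * 2 + d * 2) (collatzForm k d)
Monic-collatzForm k d =
  Monic-⊕ (Monic-⊗ (Monic-^P Monic-M (k + 1)) (Monic-^P Monic-S d))
    (≤-trans (m≤n+m 1 k) (≤-trans (m≤m*n (k + 1) 2) (m≤m+n ((k + 1) * 2) (d * 2))))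
  where
  Monic-M : Monic 2 M
  Monic-M = monic-∷ true (monic-∷ true monic-one)
  Monic-S : Monic 2 S
  Monic-S = monic-∷ false (monic-∷ true monic-one)

deg-collatzForm : ∀ k d {n} → k + 1 + d ≡ n → deg (collatzForm k d) ≡ n * 2
deg-collatzForm k d k+1+d≡n =
  trans (deg-Monic (Monic-collatzForm k d)) (trans (sym (*-distribʳ-+ 2 (k + 1) d)) (cong (_* 2) k+1+d≡n))

-- Stripping the factors x and x + 1

-- (x + 1) q + a, computed with a carry
mulX+1c : Bool → Poly → Poly
mulX+1c a []       = a ∷ []
mulX+1c a (c ∷ cs) = (a xor c) ∷ mulX+1c c cs

mulX+1 : Poly → Poly
mulX+1 = mulX+1c false

mulX+1^ : ℕ → Poly → Poly
mulX+1^ zero    q = q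
mulX+1^ (suc n) q = mulX+1 (mulX+1^ n q)

-- x ^ n (x + 1) ^ n q, in the shape from which removeX and removeX1fuel peel the factors
mulSⁿ : ℕ → Poly → Poly
mulSⁿ n q = replicate n false ++ mulX+1^ n q

addRaw-∷-self : ∀ a q → addRaw q (a ∷ q) ≡ mulX+1c a q
addRaw-∷-self a []       = refl
addRaw-∷-self a (c ∷ cs) = cong₂ _∷_ (xor-comm c a) (addRaw-∷-self c cs)

S⊗≈ : ∀ q → S ⊗ q ≈ false ∷ mulX+1 q
S⊗≈ q = ≈-trans (⊗≈mulRaw S q)
  (∷-congʳ (≈-trans (addRaw-cong (≈-refl {q}) (∷-congʳ (addRaw-false q))) (≡⇒≈ (addRaw-∷-self false q))))

mulX+1-replicate : ∀ n w → mulX+1 (replicate n false ++ w) ≡ replicate n false ++ mulX+1 w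
mulX+1-replicate zero    w = refl
mulX+1-replicate (suc n) w = cong (false ∷_) (mulX+1-replicate n w)

S⊗mulSⁿ : ∀ n q → S ⊗ mulSⁿ n q ≈ mulSⁿ (suc n) q
S⊗mulSⁿ n q = ≈-trans (S⊗≈ (mulSⁿ n q)) (≡⇒≈ (cong (false ∷_) (mulX+1-replicate n (mulX+1^ n q))))

S^≈mulSⁿ : ∀ n → S ^P n ≈ mulSⁿ n oneP
S^≈mulSⁿ zero    = ≈-refl
S^≈mulSⁿ (suc n) = ≈-trans (⊗-cong (≈-refl {S}) (S^≈mulSⁿ n)) (S⊗mulSⁿ n oneP)

Monic-mulX+1^ : ∀ {m q} → Monic m q → ∀ n → Monic (n + m) (mulX+1^ n q)
Monic-mulX+1^ mq zero    = mq
Monic-mulX+1^ mq (suc n) = Monic-mulX+1c (Monic-mulX+1^ mq n)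
  where
  Monic-mulX+1c : ∀ {a m q} → Monic m q → Monic (suc m) (mulX+1c a q)
  Monic-mulX+1c monic-one      = monic-∷ _ monic-one
  Monic-mulX+1c (monic-∷ _ mq) = monic-∷ _ (Monic-mulX+1c mq)

Monic-mulSⁿ : ∀ {m q} → Monic m q → ∀ n → Monic (n + (n + m)) (mulSⁿ n q)
Monic-mulSⁿ mq n = Monic-replicate n (Monic-mulX+1^ mq n)
  where
  Monic-replicate : ∀ {m w} n → Monic m w → Monic (n + m) (replicate n false ++ w)
  Monic-replicate zero    mw = mw
  Monic-replicate (suc n) mw = monic-∷ false (Monic-replicate n mw)

xor-cancelʳ : ∀ a z → (a xor z) xor z ≡ a
xor-cancelʳ a z = trans (xor-assoc a z z) (trans (cong (a xor_) (xor-same z)) (xor-identityʳ a))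

xor-telescope : ∀ a z z' → (a xor z) xor (z xor z') ≡ a xor z'
xor-telescope a z z' = trans (sym (xor-assoc (a xor z) z z')) (cong (_xor z') (xor-cancelʳ a z))

divX1-mulX+1c : ∀ a z zs → divX1 (mulX+1c a (z ∷ zs)) ≡ (not a , map (a xor_) (z ∷ zs))
divX1-mulX+1c a z []        rewrite xor-cancelʳ a z = refl
divX1-mulX+1c a z (z' ∷ zs) rewrite xor-telescope a z z' =
  cong (λ result → proj₁ result , (a xor z) ∷ proj₂ result) (divX1-mulX+1c a z' zs)

divX1-mulX+1 : ∀ w ws → divX1 (mulX+1 (w ∷ ws)) ≡ (true , w ∷ ws)
divX1-mulX+1 w ws = trans (divX1-mulX+1c false w ws) (cong (true ,_) (map-id (w ∷ ws)))

divX1-indivisible : ∀ c cs → proj₁ (divX1 (c ∷ cs)) ≡ not (eval true (c ∷ cs))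
divX1-indivisible c []       = cong not (sym (xor-identityʳ c))
divX1-indivisible c (d ∷ ds) =
  trans (divX1-indivisible (c xor d) ds) (cong not (xor-assoc c d (eval true ds)))

removeX1fuel-indivisible : ∀ f c cs → eval true (c ∷ cs) ≡ true → removeX1fuel (suc f) (c ∷ cs) ≡ c ∷ cs
removeX1fuel-indivisible f c cs root with divX1 (c ∷ cs) | divX1-indivisible c cs
... | false , _ | _         = refl
... | true  , _ | divisible with trans divisible (cong not root)
...   | ()

removeX1fuel-divisible : ∀ f c cs w → divX1 (c ∷ cs) ≡ (true , w) →
  removeX1fuel (suc f) (c ∷ cs) ≡ removeX1fuel f (norm w)
removeX1fuel-divisible f c cs w divisible rewrite divisible = refl

removeX1fuel-mulX+1^ : ∀ {m q} → Monic m q → eval true q ≡ true →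
  ∀ n f → n ≤ f → removeX1fuel f (mulX+1^ n q) ≡ q
removeX1fuel-mulX+1^ mq root zero zero    _ = refl
removeX1fuel-mulX+1^ (monic-∷ c {p = cs} _) root zero (suc f) _ = removeX1fuel-indivisible f c cs root
removeX1fuel-mulX+1^ monic-one root zero (suc f) _ = refl
removeX1fuel-mulX+1^ {q = q} mq root (suc n) (suc f) (s≤s n≤f)
  with mulX+1^ n q | Monic-mulX+1^ mq n | removeX1fuel-mulX+1^ mq root n f n≤f
... | w ∷ ws | mw | stripped =
  trans (removeX1fuel-divisible f w _ (w ∷ ws) (divX1-mulX+1 w ws))
    (trans (cong (removeX1fuel f) (Monic⇒Normal mw)) stripped)

eval₀-mulX+1^ : ∀ n q → eval false (mulX+1^ n q) ≡ eval false q
eval₀-mulX+1^ zero    q = refl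
eval₀-mulX+1^ (suc n) q = trans eval₀-mulX+1 (eval₀-mulX+1^ n q)
  where
  w : Poly
  w = mulX+1^ n q
  eval₀-mulX+1 : eval false (mulX+1 w) ≡ eval false w
  eval₀-mulX+1 = trans (cong (eval false) (sym (addRaw-∷-self false w)))
    (trans (eval-addRaw false w (false ∷ w)) (xor-identityʳ (eval false w)))

removeX-unit : ∀ w → eval false w ≡ true → removeX w ≡ w
removeX-unit (true ∷ _) _ = refl

removeX-replicate : ∀ n w → removeX (replicate n false ++ w) ≡ removeX w
removeX-replicate zero    w = refl
removeX-replicate (suc n) w = removeX-replicate n w

oddPart-mulSⁿ : ∀ {m q} → Monic m q → eval false q ≡ true → eval true q ≡ true →
  ∀ n → oddPart (mulSⁿ n q) ≡ q
oddPart-mulSⁿ {q = q} mq root₀ root₁ n = begin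
  removeX1fuel (length W) (removeX (norm W))
    ≡⟨ cong (λ p → removeX1fuel (length W) (removeX p)) (Monic⇒Normal (Monic-mulSⁿ mq n)) ⟩
  removeX1fuel (length W) (removeX W)
    ≡⟨ cong (removeX1fuel (length W)) (removeX-replicate n V) ⟩
  removeX1fuel (length W) (removeX V)
    ≡⟨ cong (removeX1fuel (length W)) (removeX-unit V (trans (eval₀-mulX+1^ n q) root₀)) ⟩
  removeX1fuel (length W) V
    ≡⟨ removeX1fuel-mulX+1^ mq root₁ n (length W) fuel ⟩
  q ∎
  where
  open ≡-Reasoning
  V W : Poly
  V = mulX+1^ n q
  W = mulSⁿ n q
  fuel : n ≤ length W
  fuel = ≤-trans (≤-reflexive (sym (length-replicate n))) (length-++-≤ˡ (replicate n false))

-- The Collatz trajectory of 1 + M + ⋯ + M ^ (2 ^ r)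

isEven-2k+1 : ∀ k → isEven (2 * k + 1) ≡ false
isEven-2k+1 zero    = refl
isEven-2k+1 (suc k) = trans (cong (λ n → isEven (n + 1)) (*-suc 2 k)) (trans (not-involutive _) (isEven-2k+1 k))

collatz-next-odd : ∀ B k → collatz B (2 * suc k + 1) ≡ oddPart (oneP ⊕ M ⊗ collatz B (2 * k + 1))
collatz-next-odd B k = trans (cong (λ n → collatz B (n + 1)) (*-suc 2 k)) (two-steps {2 * k + 1} (isEven-2k+1 k))
  where
  two-steps : ∀ {n} → isEven n ≡ false → collatz B (suc (suc n)) ≡ oddPart (oneP ⊕ M ⊗ collatz B n)
  two-steps odd rewrite odd = refl

geomSum-Normal : ∀ p n → Normal (geomSum p n)
geomSum-Normal p zero    = refl
geomSum-Normal p (suc n) = norm-Normal (addRaw (geomSum p n) (p ^P suc n))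

oddPart-collatzForm : ∀ k d n → oddPart (mulSⁿ n (collatzForm k (suc d))) ≡ collatzForm k (suc d)
oddPart-collatzForm k d =
  oddPart-mulSⁿ (Monic-collatzForm k (suc d)) (eval-collatzForm false k d) (eval-collatzForm true k d)

collatzForm-Normal : ∀ k d → Normal (collatzForm k d)
collatzForm-Normal k d = norm-Normal (addRaw oneP (M ^P (k + 1) ⊗ S ^P d))

A : ℕ → Poly
A r = geomSum M (2 ^ r)

A≡collatzForm : ∀ r → A r ≡ collatzForm 0 (2 ^ r ∸ 1)
A≡collatzForm r =
  Normal-≈⇒≡ (geomSum-Normal M (2 ^ r)) (collatzForm-Normal 0 (2 ^ r ∸ 1)) (geomSum≈collatzForm r)

deg-A : ∀ r → deg (A r) ≡ 2 ^ r * 2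
deg-A r = trans (cong deg (A≡collatzForm r)) (deg-collatzForm 0 (2 ^ r ∸ 1) (sym (2^r≡suc r)))

collatz-odd≡collatzForm : ∀ r k d → k + suc (suc d) ≡ 2 ^ r →
  collatz (A r) (2 * k + 1) ≡ collatzForm k (suc d)
collatz-odd≡collatzForm r zero d 2+d≡2^r = begin
  oddPart (A r)                           ≡⟨ cong oddPart (A≡collatzForm r) ⟩
  oddPart (collatzForm 0 (2 ^ r ∸ 1))     ≡⟨ cong (λ n → oddPart (collatzForm 0 (n ∸ 1))) 2+d≡2^r ⟨
  oddPart (collatzForm 0 (suc d))         ≡⟨ oddPart-collatzForm 0 d 0 ⟩
  collatzForm 0 (suc d)                   ∎
  where open ≡-Reasoning
collatz-odd≡collatzForm r (suc k) d k+2+d≡2^r = begin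
  collatz (A r) (2 * suc k + 1)                         ≡⟨ collatz-next-odd (A r) k ⟩
  oddPart (oneP ⊕ M ⊗ collatz (A r) (2 * k + 1))        ≡⟨ cong (λ p → oddPart (oneP ⊕ M ⊗ p)) previous ⟩
  oddPart (oneP ⊕ M ⊗ collatzForm k (suc (suc d)))      ≡⟨ cong oddPart factored ⟩
  oddPart (mulSⁿ 1 (collatzForm (suc k) (suc d)))       ≡⟨ oddPart-collatzForm (suc k) d 1 ⟩
  collatzForm (suc k) (suc d)                           ∎
  where
  open ≡-Reasoning
  previous : collatz (A r) (2 * k + 1) ≡ collatzForm k (suc (suc d))
  previous = collatz-odd≡collatzForm r k (suc d) (trans (+-suc k (suc (suc d))) k+2+d≡2^r)
  next : Poly
  next = collatzForm (suc k) (suc d)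
  factored : oneP ⊕ M ⊗ collatzForm k (suc (suc d)) ≡ mulSⁿ 1 next
  factored =
    Normal-≈⇒≡ (norm-Normal (addRaw oneP (M ⊗ collatzForm k (suc (suc d)))))
      (Monic⇒Normal (Monic-mulSⁿ (Monic-collatzForm (suc k) (suc d)) 1))
      (≈-trans (collatzForm-step k (suc d)) (S⊗mulSⁿ 0 next))

collatz-final≡oneP : ∀ r k → k + 2 ≡ 2 ^ r → collatz (A r) (2 * suc k + 1) ≡ oneP
collatz-final≡oneP r k k+2≡2^r = begin
  collatz (A r) (2 * suc k + 1)                  ≡⟨ collatz-next-odd (A r) k ⟩
  oddPart (oneP ⊕ M ⊗ collatz (A r) (2 * k + 1)) ≡⟨ cong (λ p → oddPart (oneP ⊕ M ⊗ p)) previous ⟩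
  oddPart (oneP ⊕ M ⊗ collatzForm k 1)           ≡⟨ cong oddPart factored ⟩
  oddPart (mulSⁿ (suc (2 ^ r)) oneP)             ≡⟨ oddPart-mulSⁿ monic-one refl refl (suc (2 ^ r)) ⟩
  oneP                                           ∎
  where
  open ≡-Reasoning
  previous : collatz (A r) (2 * k + 1) ≡ collatzForm k 1
  previous = collatz-odd≡collatzForm r k 0 k+2≡2^r
  factored : oneP ⊕ M ⊗ collatzForm k 1 ≡ mulSⁿ (suc (2 ^ r)) oneP
  factored =
    Normal-≈⇒≡ (norm-Normal (addRaw oneP (M ⊗ collatzForm k 1)))
      (Monic⇒Normal (Monic-mulSⁿ monic-one (suc (2 ^ r))))
    (≈-trans (collatzForm-step k 0)
      (≈-trans (⊗-cong (≈-refl {S}) (collatzForm-last r (suc k) (trans (sym (+-suc k 1)) k+2≡2^r)))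
        (S^≈mulSⁿ (suc (2 ^ r)))))

2+[2^r∸2]≡2^r : ∀ r → r ≥ 1 → 2 + (2 ^ r ∸ 2) ≡ 2 ^ r
2+[2^r∸2]≡2^r (suc r) _ = m+[n∸m]≡n (*-monoʳ-≤ 2 (m^n>0 2 r))

k+2+d≡2^r : ∀ r → r ≥ 1 → ∀ k → k ≤ 2 ^ r ∸ 2 → k + suc (suc (2 ^ r ∸ 2 ∸ k)) ≡ 2 ^ r
k+2+d≡2^r r r≥1 k k≤2^r∸2 = begin
  k + suc (suc d)    ≡⟨ +-suc k (suc d) ⟩
  suc (k + suc d)    ≡⟨ cong suc (+-suc k d) ⟩
  2 + (k + d)        ≡⟨ cong (2 +_) (m+[n∸m]≡n k≤2^r∸2) ⟩
  2 + (2 ^ r ∸ 2)    ≡⟨ 2+[2^r∸2]≡2^r r r≥1 ⟩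
  2 ^ r              ∎
  where
  open ≡-Reasoning
  d : ℕ
  d = 2 ^ r ∸ 2 ∸ k

collatz-odd-formula : ∀ r k d → k + suc (suc d) ≡ 2 ^ r →
  collatz (A r) (2 * k + 1) ≡ oneP ⊕ M ^P (k + 1) ⊗ S ^P (2 ^ r ∸ k ∸ 1)
collatz-odd-formula r k d k+2+d≡2^r =
  trans (collatz-odd≡collatzForm r k d k+2+d≡2^r) (cong (collatzForm k) (sym exponent))
  where
  exponent : 2 ^ r ∸ k ∸ 1 ≡ suc d
  exponent = trans (cong (λ n → n ∸ k ∸ 1) (sym k+2+d≡2^r)) (cong (_∸ 1) (m+n∸m≡n k (suc (suc d))))

deg-collatz-odd : ∀ r k d → k + suc (suc d) ≡ 2 ^ r → deg (collatz (A r) (2 * k + 1)) ≡ deg (A r)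
deg-collatz-odd r k d k+2+d≡2^r =
  trans (cong deg (collatz-odd≡collatzForm r k d k+2+d≡2^r))
    (trans (deg-collatzForm k (suc d) (trans (+-assoc k 1 (suc d)) k+2+d≡2^r)) (sym (deg-A r)))

collatz-odd≢oneP : ∀ r k d → k + suc (suc d) ≡ 2 ^ r → collatz (A r) (2 * k + 1) ≢ oneP
collatz-odd≢oneP r k d k+2+d≡2^r is-one =
  deg-A-nonzero (trans (sym (cong deg is-one)) (trans (deg-collatz-odd r k d k+2+d≡2^r) (deg-A r)))
  where
  deg-A-nonzero : 0 ≢ 2 ^ r * 2
  deg-A-nonzero = subst (λ n → 0 ≢ n * 2) (sym (2^r≡suc r)) (λ ())

lemma3p1 : (r : ℕ) → r ≥ 1 →
    ((k : ℕ) → k ≤ 2 ^ r ∸ 2 →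
      (collatz (geomSum M (2 ^ r)) (2 * k + 1)
         ≡ oneP ⊕ (M ^P (k + 1)) ⊗ ((M ⊕ oneP) ^P (2 ^ r ∸ k ∸ 1)))
      × (deg (collatz (geomSum M (2 ^ r)) (2 * k + 1)) ≡ deg (geomSum M (2 ^ r))))
    × (collatz (geomSum M (2 ^ r)) (2 * (2 ^ r ∸ 1) + 1) ≡ oneP)
    × CollatzLength (geomSum M (2 ^ r)) (2 ^ r)
lemma3p1 r r≥1 =
  odd-iterates , last-is-one , (2 ^ r ∸ 1 , 2^r≡suc r , last-is-one , earlier-not-one)
  where
  split : ∀ k → k ≤ 2 ^ r ∸ 2 → k + suc (suc (2 ^ r ∸ 2 ∸ k)) ≡ 2 ^ r
  split = k+2+d≡2^r r r≥1
  2^r∸1≡suc[2^r∸2] : 2 ^ r ∸ 1 ≡ suc (2 ^ r ∸ 2)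
  2^r∸1≡suc[2^r∸2] = cong (_∸ 1) (sym (2+[2^r∸2]≡2^r r r≥1))
  odd-iterates : (k : ℕ) → k ≤ 2 ^ r ∸ 2 →
    (collatz (A r) (2 * k + 1) ≡ oneP ⊕ M ^P (k + 1) ⊗ S ^P (2 ^ r ∸ k ∸ 1))
    × (deg (collatz (A r) (2 * k + 1)) ≡ deg (A r))
  odd-iterates k k≤ = collatz-odd-formula r k _ (split k k≤) , deg-collatz-odd r k _ (split k k≤)
  last-is-one : collatz (A r) (2 * (2 ^ r ∸ 1) + 1) ≡ oneP
  last-is-one = trans (cong (λ n → collatz (A r) (2 * n + 1)) 2^r∸1≡suc[2^r∸2])
    (collatz-final≡oneP r (2 ^ r ∸ 2) (trans (+-comm (2 ^ r ∸ 2) 2) (2+[2^r∸2]≡2^r r r≥1)))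
  earlier-not-one : (k : ℕ) → k < 2 ^ r ∸ 1 → collatz (A r) (2 * k + 1) ≢ oneP
  earlier-not-one k k< = collatz-odd≢oneP r k _ (split k (≤-pred (subst (suc k ≤_) 2^r∸1≡suc[2^r∸2] k<)))
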